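{- Let $(G,R)$ be a finite rooted graph without sinks such that $t^{ -1}(R)=\emptyset$ and $|o^{ -1}(R)|>2$. If the unfolding tree $\mathcal{T}(G,R)$ is cocompact, then $(G,R)$ admits an actual labelling.
   Context: A graph $G=(VG,EG,o,t)$ is a directed multigraph (loops and multiple edges allowed) with origin and terminus maps $o,t:EG\to VG$. A sink is a vertex $v$ with $o^{ -1}(v)=\emptyset$. A path is either an empty path $\varepsilon_v$ or a finite sequence $e_1\cdots e_n$ of edges with $t(e_i)=o(e_{i+1})$; $O(p),T(p)$ denote its origin and terminus. A rooted graph $(G,R)$ is a graph with a vertex $R$ from which every vertex is reachable by a directed path. A rooted tree is a graph with a vertex $R$ such that every vertex has a unique path from $R$. The unfolding tree $\mathcal{T}(G,R)$ has as vertices the paths $p$ with $O(p)=R$ and an edge $(p,pe)$ from $p$ to $pe$ for each such $p$ and each edge $e$ with $o(e)=T(p)$. For a rooted tree $\mathcal{T}$ with root $R$ and vertex $v$, $\mathcal{T}^v$ is obtained by reversing every edge on the path from $R$ to $v$. $\cong$ is isomorphism of directed graphs. A rooted tree $\mathcal{T}$ is cocompact if there are a finite set $F$ and $l:V\mathcal{T}\to F$ with $l(v)=l(w)\Rightarrow \mathcal{T}^v\cong\mathcal{T}^w$. Multisets over $X$ have positive integer multiplicities; union adds multiplicities; $M\setminus\{x\}$ removes one copy. $t_m(o^{ -1}(v))$ is the multiset of termini of edges leaving $v$ counted with the number of edges; $l(t_m(o^{ -1}(v)))$ its multiset of labels. Actual labelling of $(G,R)$ with $t^{ -1}(R)=\emptyset$: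 a finite set $X$, maps $l:VG\to X$, $l_p:VG\setminus\{R\}\to X$, and multisets $M_x$ over $X$ ($x\in X$) such that for every $v\ne R$: (1) $l_p(v)\in M_{l(v)}$; (2) $l(t_m(o^{ -1}(v)))=M_{l(v)}\setminus\{l_p(v)\}$; (3) $l(o(e))=l_p(v)$ for every edge $e$ with $t(e)=v$; and (4) $l(t_m(o^{ -1}(R)))=M_{l(R)}$. -}

module Defs where

open import Data.Nat using (ℕ; zero; suc; _∸_; _≤_; _<_)
open import Data.Fin using (Fin; _≟_)
open import Data.List using (List; []; _∷_; length; filter; allFin)
open import Data.List.Properties using (≡-dec)
open import Data.Bool using (Bool; true; false; if_then_else_; _∨_)
open import Data.Product using (Σ; ∃; ∃-syntax; _×_; _,_; proj₁; proj₂)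
open import Relation.Nullary using (¬_; does)
open import Relation.Nullary.Decidable using (_×-dec_)
open import Relation.Binary.PropositionalEquality using (_≡_)
open import Function.Bundles using (_↔_; Inverse)

record Graph : Set₁ where
  field
    V   : Set
    E   : Set
    src : E → V
    tgt : E → V

open Graph public

_≅_ : Graph → Graph → Set
G ≅ H = Σ (V G ↔ V H) λ φ → Σ (E G ↔ E H) λ ψ →
          ((e : E G) → src H (Inverse.to ψ e) ≡ Inverse.to φ (src G e))
        × ((e : E G) → tgt H (Inverse.to ψ e) ≡ Inverse.to φ (tgt G e))

isSuffix : {m : ℕ} → List (Fin m) → List (Fin m) → Bool
isSuffix xs [] = does (≡-dec _≟_ xs [])
isSuffix xs (y ∷ ys) = does (≡-dec _≟_ xs (y ∷ ys)) ∨ isSuffix xs ys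

module FinGraph {n m : ℕ} (o t : Fin m → Fin n) (R : Fin n) where

  -- Paths starting at R, stored in REVERSED order (last edge first).
  -- endR p = terminus T(p) of the path p (T(ε_R) = R).
  endR : List (Fin m) → Fin n
  endR [] = R
  endR (e ∷ es) = t e

  data ValidFromR : List (Fin m) → Set where
    ε   : ValidFromR []
    ext : {es : List (Fin m)} (e : Fin m) → ValidFromR es → o e ≡ endR es → ValidFromR (e ∷ es)

  Rooted : Set
  Rooted = (v : Fin n) → ∃[ p ] (ValidFromR p × endR p ≡ v)

  NoSinks : Set
  NoSinks = (v : Fin n) → ∃[ e ] (o e ≡ v)

  NoEdgeIntoRoot : Set
  NoEdgeIntoRoot = (e : Fin m) → ¬ (t e ≡ R)

  outdeg : Fin n → ℕ
  outdeg v = length (filter (λ e → o e ≟ v) (allFin m))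

  TV : Set
  TV = Σ (List (Fin m)) ValidFromR

  TE : Set
  TE = Σ TV λ p → Σ (Fin m) λ e → o e ≡ endR (proj₁ p)

  TSrc : TE → TV
  TSrc (p , e , h) = p

  TTgt : TE → TV
  TTgt ((es , vp) , e , h) = (e ∷ es , ext e vp h)

  UnfoldingTree : Graph
  UnfoldingTree = record { V = TV ; E = TE ; src = TSrc ; tgt = TTgt }

  -- the tree edge (p, pe) lies on the path from the root to v iff pe is a
  -- prefix of v (i.e. a suffix in our reversed representation)
  onRootPath : TE → TV → Bool
  onRootPath ((es , _) , e , _) (ws , _) = isSuffix (e ∷ es) ws

  Tree^ : TV → Graph
  Tree^ v = record
    { V = TV
    ; E = TE
    ; src = λ d → if onRootPath d v then TTgt d else TSrc d
    ; tgt = λ d → if onRootPath d v then TSrc d else TTgt d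
    }

  -- cocompactness of the unfolding tree (finite label set F ≅ Fin k)
  CocompactUnfolding : Set
  CocompactUnfolding =
    ∃[ k ] Σ (TV → Fin k) λ l → (v w : TV) → l v ≡ l w → Tree^ v ≅ Tree^ w

  -- Actual labelling.  Multisets over Fin k are multiplicity functions Fin k → ℕ.

  labelMult : {k : ℕ} → (Fin n → Fin k) → Fin n → Fin k → ℕ
  labelMult l v x = length (filter (λ e → (o e ≟ v) ×-dec (l (t e) ≟ x)) (allFin m))

  removeOne : {k : ℕ} → (Fin k → ℕ) → Fin k → Fin k → ℕ
  removeOne M y x = if does (x ≟ y) then M x ∸ 1 else M x

  -- l_p is taken as a total function; only its values on v ≠ R matter.
  record ActualLabelling : Set where
    field
      k  : ℕ
      l  : Fin n → Fin k
      lp : Fin n → Fin k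
      M  : Fin k → Fin k → ℕ
      cond1 : (v : Fin n) → ¬ (v ≡ R) → 1 ≤ M (l v) (lp v)
      cond2 : (v : Fin n) → ¬ (v ≡ R) → (x : Fin k) →
              labelMult l v x ≡ removeOne (M (l v)) (lp v) x
      cond3 : (v : Fin n) → ¬ (v ≡ R) → (e : Fin m) → t e ≡ v → l (o e) ≡ lp v
      cond4 : (x : Fin k) → labelMult l R x ≡ M (l R) x

-- Write x ∼[ k ] y when x and y get the same colour in k rounds of colour refinement on the
-- unfolding tree with its edges undirected.  An isomorphism Tree^ a ≅ Tree^ b sends a, the only
-- vertex of Tree^ a without incoming edges, to b and preserves colours, so a ∼[ k ] b for all k.
-- While refinement is not stable at round j it has produced j + 2 pairwise inequivalent vertices
-- at round j + 1, so a cocompactness labelling with k values forces stability at round k.  Given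
-- stability and no sinks, tree vertices ending at the same graph vertex are ∼[ k ]-equivalent:
-- this is clear when their paths share the last k + 1 edges, and it passes to shorter shared
-- tails by comparing two children along a common edge and cancelling their equivalent children.
-- A graph vertex is then labelled by its ∼[ k ]-class, M_x is the multiset of labels of the tree
-- neighbours of a vertex labelled x, and l_p is the label of the tree parent.
module Submission where

open import Defs
open import Axiom.UniquenessOfIdentityProofs using (module Decidable⇒UIP)
open import Data.Bool using (true; false; if_then_else_; _∨_)
open import Data.Bool.Properties using (∨-zeroʳ)
open import Data.Fin using (Fin; zero; suc; _≟_)
open import Data.Fin.Properties using (pigeonhole; <⇒≢) renaming (any? to anyFin?)
open import Data.List using (List; []; _∷_; _++_; length; map; filter; allFin)
open import Data.List.Properties
  using (≡-dec; ∷-injectiveˡ; length-++; filter-++; filter-none; filter-≐; filter-accept; filter-reject)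
open import Data.List.Membership.Propositional using (_∈_; find)
open import Data.List.Membership.Propositional.Properties
  using (∈-++⁺ˡ; ∈-++⁺ʳ; ∈-allFin; ∈-map⁺; ∈-map⁻)
open import Data.List.Membership.Propositional.Properties.WithK using (unique∧set⇒bag)
open import Data.List.Relation.Binary.BagAndSetEquality using (∼bag⇒↭)
open import Data.List.Relation.Binary.Permutation.Propositional using (_↭_)
open import Data.List.Relation.Binary.Permutation.Propositional.Properties using (↭-length; filter-↭)
open import Data.List.Relation.Binary.Pointwise as Pointwise
  using (Pointwise; []; _∷_; ≡⇒Pointwise-≡; Pointwise-≡⇒≡)
open import Data.List.Relation.Binary.Suffix.Heterogeneous using (Suffix; here; there)
open import Data.List.Relation.Binary.Suffix.Heterogeneous.Properties using (S[as][bs]⇒∣as∣≢1+∣bs∣)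
open import Data.List.Relation.Unary.All as All using (All)
open import Data.List.Relation.Unary.All.Properties as All using (¬Any⇒All¬; ¬All⇒Any¬)
open import Data.List.Relation.Unary.AllPairs using ([]; _∷_)
open import Data.List.Relation.Unary.Any using (here; there; any?)
open import Data.List.Relation.Unary.Unique.Propositional using (Unique)
open import Data.List.Relation.Unary.Unique.Propositional.Properties as Unique using (allFin⁺)
open import Data.Nat using (ℕ; zero; suc; _+_; _∸_; _≤_; _<_; z≤n; s≤s) renaming (_≟_ to _≟ℕ_)
open import Data.Nat.Properties using (n≤1+n; 1+n≢n; m≤n⇒m≤1+n; +-suc; +-identityʳ)
open import Data.Product using (Σ; ∃; ∃-syntax; _×_; _,_; proj₁; proj₂; map₂)
open import Data.Sum using (_⊎_; inj₁; inj₂; swap)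
open import Data.Unit using (⊤; tt)
open import Function using (_∘_; id)
open import Function.Bundles using (Inverse; Injection; Equivalence; _⇔_; mk⇔)
open import Function.Properties.Inverse using (↔-sym; ↔⇒↣)
open import Relation.Binary.PropositionalEquality
  using (_≡_; _≢_; refl; sym; trans; cong; cong₂; subst; module ≡-Reasoning)
open import Relation.Nullary using (¬_; Dec; yes; no; does; contradiction)
open import Relation.Nullary.Decidable using (dec-true; decidable-stable; _×-dec_; ¬?)
open import Relation.Unary using (Decidable; ∁)

open ≡-Reasoning

module _ {A : Set} {P : A → Set} (P? : Decidable P) where

  count : List A → ℕ
  count xs = length (filter P? xs)

  count-++ : ∀ xs ys → count (xs ++ ys) ≡ count xs + count ys
  count-++ xs ys = trans (cong length (filter-++ P? xs ys)) (length-++ (filter P? xs))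

  count-↭ : ∀ {xs ys} → xs ↭ ys → count xs ≡ count ys
  count-↭ p = ↭-length (filter-↭ P? p)

  count-none : ∀ {xs} → All (∁ P) xs → count xs ≡ 0
  count-none h = cong length (filter-none P? h)

module _ {A B : Set} {P : A → Set} {Q : B → Set} (P? : Decidable P) (Q? : Decidable Q) where

  count-pointwise : {R : A → B → Set} →
                    (∀ {x y} → R x y → P x → Q y) → (∀ {x y} → R x y → Q y → P x) →
                    ∀ {xs ys} → Pointwise R xs ys → count P? xs ≡ count Q? ys
  count-pointwise to from [] = refl
  count-pointwise to from {x ∷ _} {y ∷ _} (r ∷ rs) with P? x | Q? y
  ... | yes _ | yes _ = cong suc (count-pointwise to from rs)
  ... | yes p | no ¬q = contradiction (to r p) ¬q
  ... | no ¬p | yes q = contradiction (from r q) ¬p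
  ... | no _  | no _  = count-pointwise to from rs

module _ {A : Set} {P Q : A → Set} (P? : Decidable P) (Q? : Decidable Q) where

  count-cong-∈ : ∀ xs → (∀ {x} → x ∈ xs → P x → Q x) → (∀ {x} → x ∈ xs → Q x → P x) →
                 count P? xs ≡ count Q? xs
  count-cong-∈ [] to from = refl
  count-cong-∈ (x ∷ xs) to from with P? x | Q? x
  ... | yes _ | yes _ = cong suc (count-cong-∈ xs (to ∘ there) (from ∘ there))
  ... | yes p | no ¬q = contradiction (to (here refl) p) ¬q
  ... | no ¬p | yes q = contradiction (from (here refl) q) ¬p
  ... | no _  | no _  = count-cong-∈ xs (to ∘ there) (from ∘ there)

least : ∀ {c} {P : Fin c → Set} → Decidable P → ∃ P → Fin c
least {suc c} {P} P? p with P? zero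
... | yes _ = zero
... | no ¬p₀ = suc (least (P? ∘ suc) (witness-suc p))
  where
  witness-suc : ∃ P → ∃ (P ∘ suc)
  witness-suc (zero , p₀) = contradiction p₀ ¬p₀
  witness-suc (suc i , pᵢ) = i , pᵢ

least-satisfies : ∀ {c} {P : Fin c → Set} (P? : Decidable P) (p : ∃ P) → P (least P? p)
least-satisfies {suc c} P? p with P? zero
... | yes p₀ = p₀
... | no _ = least-satisfies (P? ∘ suc) _

least-cong : ∀ {c} {P Q : Fin c → Set} (P? : Decidable P) (Q? : Decidable Q) (p : ∃ P) (q : ∃ Q) →
             (∀ i → P i → Q i) → (∀ i → Q i → P i) → least P? p ≡ least Q? q
least-cong {suc c} P? Q? p q to from with P? zero | Q? zero
... | yes _  | yes _  = refl
... | yes p₀ | no ¬q₀ = contradiction (to zero p₀) ¬q₀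
... | no ¬p₀ | yes q₀ = contradiction (from zero q₀) ¬p₀
... | no _   | no _   = cong suc (least-cong (P? ∘ suc) (Q? ∘ suc) _ _ (to ∘ suc) (from ∘ suc))

Joins : (G : Graph) → E G → V G → V G → Set
Joins G d z w = (src G d ≡ z × tgt G d ≡ w) ⊎ (tgt G d ≡ z × src G d ≡ w)

≅-Joins : ∀ {G H} ((φ , ψ , src-comm , tgt-comm) : G ≅ H) {d z w} →
          Joins G d z w → Joins H (Inverse.to ψ d) (Inverse.to φ z) (Inverse.to φ w)
≅-Joins (_ , _ , src-comm , tgt-comm) (inj₁ (refl , refl)) = inj₁ (src-comm _ , tgt-comm _)
≅-Joins (_ , _ , src-comm , tgt-comm) (inj₂ (refl , refl)) = inj₂ (tgt-comm _ , src-comm _)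

≅-sym : ∀ {G H} → G ≅ H → H ≅ G
≅-sym {G} {H} (φ , ψ , src-comm , tgt-comm) =
  ↔-sym φ , ↔-sym ψ , commute (src G) (src H) src-comm , commute (tgt G) (tgt H) tgt-comm
  where
  commute : (f : E G → V G) (g : E H → V H) → (∀ e → g (Inverse.to ψ e) ≡ Inverse.to φ (f e)) →
            ∀ e → f (Inverse.from ψ e) ≡ Inverse.from φ (g e)
  commute f g comm e = begin
    f (Inverse.from ψ e)                                 ≡⟨ Inverse.strictlyInverseʳ φ _ ⟨
    Inverse.from φ (Inverse.to φ (f (Inverse.from ψ e))) ≡⟨ cong (Inverse.from φ) (comm _) ⟨
    Inverse.from φ (g (Inverse.to ψ (Inverse.from ψ e))) ≡⟨ cong (Inverse.from φ ∘ g) (Inverse.strictlyInverseˡ ψ e) ⟩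
    Inverse.from φ (g e)                                 ∎

isSuffix⇒Suffix : ∀ {m} {xs} (ys : List (Fin m)) → isSuffix xs ys ≡ true → Suffix _≡_ xs ys
isSuffix⇒Suffix {xs = xs} [] h with ≡-dec _≟_ xs []
... | yes refl = here []
... | no _     = contradiction h λ ()
isSuffix⇒Suffix {xs = xs} (y ∷ ys) h with ≡-dec _≟_ xs (y ∷ ys)
... | yes refl = here (≡⇒Pointwise-≡ refl)
... | no _     = there (isSuffix⇒Suffix ys h)

Suffix⇒isSuffix : ∀ {m} {xs ys : List (Fin m)} → Suffix _≡_ xs ys → isSuffix xs ys ≡ true
Suffix⇒isSuffix {xs = xs} {[]} (here xs≋ys) = dec-true (≡-dec _≟_ xs []) (Pointwise-≡⇒≡ xs≋ys)
Suffix⇒isSuffix {xs = xs} {ys@(_ ∷ _)} (here xs≋ys) =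
  cong (_∨ _) (dec-true (≡-dec _≟_ xs ys) (Pointwise-≡⇒≡ xs≋ys))
Suffix⇒isSuffix {xs = xs} {y ∷ ys} (there s) =
  trans (cong (does (≡-dec _≟_ xs (y ∷ ys)) ∨_) (Suffix⇒isSuffix s)) (∨-zeroʳ _)

[]-Suffix : ∀ {m} (ys : List (Fin m)) → Suffix _≡_ [] ys
[]-Suffix [] = here []
[]-Suffix (_ ∷ ys) = there ([]-Suffix ys)

Suffix-extend : ∀ {m} {zs ys : List (Fin m)} → Suffix _≡_ zs ys → zs ≢ ys →
                ∃[ f ] Suffix _≡_ (f ∷ zs) ys
Suffix-extend (here zs≋ys) zs≢ys = contradiction (Pointwise-≡⇒≡ zs≋ys) zs≢ys
Suffix-extend (there s) _ = there-extend s
  where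
  there-extend : ∀ {m} {y : Fin m} {zs ys} → Suffix _≡_ zs ys → ∃[ f ] Suffix _≡_ (f ∷ zs) (y ∷ ys)
  there-extend {y = y} (here zs≋ys) = y , here (refl ∷ zs≋ys)
  there-extend (there s) = map₂ there (there-extend s)

module Unfolding {n m : ℕ} (o t : Fin m → Fin n) (R : Fin n) where
  open FinGraph o t R

  insertOne : ∀ {c} → (Fin c → ℕ) → Fin c → Fin c → ℕ
  insertOne L y₀ y = (if does (y ≟ y₀) then 1 else 0) + L y

  removeOne-insertOne : ∀ {c} {M L : Fin c → ℕ} {y₀} → (∀ y → M y ≡ insertOne L y₀ y) →
                        ∀ y → L y ≡ removeOne M y₀ y
  removeOne-insertOne {y₀ = y₀} M≡ y with y ≟ y₀ | M≡ y
  ... | yes _ | eq = cong (_∸ 1) (sym eq)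
  ... | no _  | eq = sym eq

  insertOne-∋ : ∀ {c} {M L : Fin c → ℕ} {y₀} → (∀ y → M y ≡ insertOne L y₀ y) → 1 ≤ M y₀
  insertOne-∋ {y₀ = y₀} M≡ with y₀ ≟ y₀ | M≡ y₀
  ... | yes _ | eq = subst (1 ≤_) (sym eq) (s≤s z≤n)
  ... | no ne | _  = contradiction refl ne

  -- The unfolding tree with its edges undirected

  path : TV → List (Fin m)
  path = proj₁

  end : TV → Fin n
  end = endR ∘ path

  ValidFromR-irrelevant : ∀ {es} (a b : ValidFromR es) → a ≡ b
  ValidFromR-irrelevant ε ε = refl
  ValidFromR-irrelevant (ext e a h) (ext .e b h′) =
    cong₂ (ext e) (ValidFromR-irrelevant a b) (Decidable⇒UIP.≡-irrelevant _≟_ h h′)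

  path-injective : ∀ {x y} → path x ≡ path y → x ≡ y
  path-injective {es , a} {.es , b} refl = cong (es ,_) (ValidFromR-irrelevant a b)

  _≟ᵀ_ : (x y : TV) → Dec (x ≡ y)
  x ≟ᵀ y with ≡-dec _≟_ (path x) (path y)
  ... | yes p = yes (path-injective p)
  ... | no ¬p = no (¬p ∘ cong path)

  child : (x : TV) (e : Fin m) → o e ≡ end x → TV
  child (es , v) e h = e ∷ es , ext e v h

  childrenVia : TV → List (Fin m) → List TV
  childrenVia x [] = []
  childrenVia x (e ∷ es) with o e ≟ end x
  ... | yes h = child x e h ∷ childrenVia x es
  ... | no _  = childrenVia x es

  children : TV → List TV
  children x = childrenVia x (allFin m)

  parent : TV → List TV
  parent ([] , ε) = []
  parent (e ∷ es , ext .e v h) = (es , v) ∷ []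

  neighbours : TV → List TV
  neighbours x = parent x ++ children x

  ∈-childrenVia⁻ : ∀ x {es w} → w ∈ childrenVia x es →
                   ∃[ e ] e ∈ es × Σ (o e ≡ end x) λ h → w ≡ child x e h
  ∈-childrenVia⁻ x {e ∷ es} w∈ with o e ≟ end x
  ∈-childrenVia⁻ x {e ∷ es} (here refl) | yes h = e , here refl , h , refl
  ∈-childrenVia⁻ x {e ∷ es} (there w∈) | yes _ with ∈-childrenVia⁻ x w∈
  ... | e′ , e′∈ , h′ , eq = e′ , there e′∈ , h′ , eq
  ∈-childrenVia⁻ x {e ∷ es} w∈ | no _ with ∈-childrenVia⁻ x w∈
  ... | e′ , e′∈ , h′ , eq = e′ , there e′∈ , h′ , eq

  ∈-childrenVia⁺ : ∀ x {e es} → e ∈ es → (h : o e ≡ end x) → child x e h ∈ childrenVia x es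
  ∈-childrenVia⁺ x {e} {e′ ∷ es} e∈ h with o e′ ≟ end x | e∈
  ... | yes _  | here refl = here (path-injective refl)
  ... | yes _  | there e∈′ = there (∈-childrenVia⁺ x e∈′ h)
  ... | no ¬h′ | here refl = contradiction h ¬h′
  ... | no _   | there e∈′ = ∈-childrenVia⁺ x e∈′ h

  childrenVia-unique : ∀ x {es} → Unique es → Unique (childrenVia x es)
  childrenVia-unique x {[]} [] = []
  childrenVia-unique x {e ∷ es} (e∉es ∷ u) with o e ≟ end x
  ... | yes h = All.tabulate fresh ∷ childrenVia-unique x u
    where
    fresh : ∀ {w} → w ∈ childrenVia x es → child x e h ≢ w
    fresh w∈ eq with ∈-childrenVia⁻ x {es} w∈
    ... | e′ , e′∈ , _ , refl = All.lookup e∉es e′∈ (∷-injectiveˡ (cong path eq))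
  ... | no _ = childrenVia-unique x u

  neighbours-unique : ∀ x → Unique (neighbours x)
  neighbours-unique ([] , ε) = childrenVia-unique _ (allFin⁺ m)
  neighbours-unique x@(e ∷ es , ext .e v h) = All.tabulate parent-not-child ∷ childrenVia-unique x (allFin⁺ m)
    where
    parent-not-child : ∀ {w} → w ∈ children x → (es , v) ≢ w
    parent-not-child w∈ eq with ∈-childrenVia⁻ x {allFin m} w∈
    ... | _ , _ , _ , refl with cong path eq
    ... | ()

  Adjacent : TV → TV → Set
  Adjacent z w = ∃[ d ] Joins UnfoldingTree d z w

  ∈-neighbours⇒Adjacent : ∀ z {w} → w ∈ neighbours z → Adjacent z w
  ∈-neighbours⇒Adjacent ([] , ε) w∈ with ∈-childrenVia⁻ ([] , ε) {allFin m} w∈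
  ... | e , _ , h , refl = (([] , ε) , e , h) , inj₁ (refl , refl)
  ∈-neighbours⇒Adjacent (e ∷ es , ext .e v h) (here refl) = ((es , v) , e , h) , inj₂ (refl , refl)
  ∈-neighbours⇒Adjacent z@(_ ∷ _ , ext _ _ _) (there w∈) with ∈-childrenVia⁻ z {allFin m} w∈
  ... | f , _ , h , refl = (z , f , h) , inj₁ (refl , refl)

  child-∈-neighbours : ∀ x e (h : o e ≡ end x) → child x e h ∈ neighbours x
  child-∈-neighbours x e h = ∈-++⁺ʳ (parent x) (∈-childrenVia⁺ x (∈-allFin e) h)

  Adjacent⇒∈-neighbours : ∀ {z w} → Adjacent z w → w ∈ neighbours z
  Adjacent⇒∈-neighbours ((x , e , h) , inj₁ (refl , refl)) = child-∈-neighbours x e h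
  Adjacent⇒∈-neighbours ((x , e , h) , inj₂ (refl , refl)) = here refl

  ChildPair : TV → TV → TV → TV → Set
  ChildPair x y a b = ∃[ f ] path a ≡ f ∷ path x × path b ≡ f ∷ path y

  childrenVia-pointwise : ∀ x y → end x ≡ end y → ∀ es →
                          Pointwise (ChildPair x y) (childrenVia x es) (childrenVia y es)
  childrenVia-pointwise x y ends≡ [] = []
  childrenVia-pointwise x y ends≡ (e ∷ es) with o e ≟ end x | o e ≟ end y
  ... | yes _ | yes _ = (e , refl , refl) ∷ childrenVia-pointwise x y ends≡ es
  ... | yes h | no ¬h = contradiction (trans h ends≡) ¬h
  ... | no ¬h | yes h = contradiction (trans h (sym ends≡)) ¬h
  ... | no _  | no _  = childrenVia-pointwise x y ends≡ es

  children-pointwise : ∀ x y → end x ≡ end y → Pointwise (ChildPair x y) (children x) (children y)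
  children-pointwise x y ends≡ = childrenVia-pointwise x y ends≡ (allFin m)

  Suffix-valid : ∀ {f} {zs ys : List (Fin m)} → Suffix _≡_ (f ∷ zs) ys → ValidFromR ys → o f ≡ endR zs
  Suffix-valid (here (refl ∷ zs≋ys)) (ext _ _ h) with refl ← Pointwise-≡⇒≡ zs≋ys = h
  Suffix-valid (there s) (ext _ v _) = Suffix-valid s v

  Tree^-no-edge-into : ∀ a d → tgt (Tree^ a) d ≢ a
  Tree^-no-edge-into a d@((p , _) , e , _) eq with onRootPath d a in onPath
  ... | true  with refl ← eq = S[as][bs]⇒∣as∣≢1+∣bs∣ (isSuffix⇒Suffix p onPath) refl
  ... | false with refl ← eq =
    contradiction (trans (sym onPath) (Suffix⇒isSuffix {xs = e ∷ p} (here (≡⇒Pointwise-≡ refl)))) λ ()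

  Tree^-edge-into : ∀ b z → z ≢ b → ∃[ d ] tgt (Tree^ b) d ≡ z
  Tree^-edge-into b z z≢b with isSuffix (path z) (path b) in onPath
  ... | true with Suffix-extend (isSuffix⇒Suffix (path b) onPath) (z≢b ∘ path-injective)
  ...   | f , s = (z , f , Suffix-valid s (proj₂ b)) , above
    where
    above : tgt (Tree^ b) (z , f , Suffix-valid s (proj₂ b)) ≡ z
    above rewrite Suffix⇒isSuffix s = refl
  Tree^-edge-into b ([] , ε) z≢b | false =
    contradiction (trans (sym onPath) (Suffix⇒isSuffix ([]-Suffix (path b)))) λ ()
  Tree^-edge-into b (e ∷ es , ext .e v h) z≢b | false = ((es , v) , e , h) , below
    where
    below : tgt (Tree^ b) ((es , v) , e , h) ≡ child (es , v) e h
    below rewrite onPath = refl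

  -- Colour refinement

  mutual
    infix 4 _∼[_]_ _∼?[_]_

    _∼[_]_ : TV → ℕ → TV → Set
    x ∼[ zero ] y = ⊤
    x ∼[ suc k ] y = x ∼[ k ] y × (∀ z → count[ k ] z (neighbours x) ≡ count[ k ] z (neighbours y))

    count[_] : ℕ → TV → List TV → ℕ
    count[ k ] z = count (z ∼?[ k ]_)

    ∼-sym : ∀ k {x y} → x ∼[ k ] y → y ∼[ k ] x
    ∼-sym zero _ = tt
    ∼-sym (suc k) (p , q) = ∼-sym k p , sym ∘ q

    ∼-trans : ∀ k {x y z} → x ∼[ k ] y → y ∼[ k ] z → x ∼[ k ] z
    ∼-trans zero _ _ = tt
    ∼-trans (suc k) (p , q) (p′ , q′) = ∼-trans k p p′ , λ z → trans (q z) (q′ z)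

    count[]-resp : ∀ k {z w} → z ∼[ k ] w → ∀ xs → count[ k ] z xs ≡ count[ k ] w xs
    count[]-resp k z∼w xs =
      cong length (filter-≐ (_ ∼?[ k ]_) (_ ∼?[ k ]_) (∼-trans k (∼-sym k z∼w) , ∼-trans k z∼w) xs)

    counts-agree : ∀ k xs ys → All (λ z → count[ k ] z xs ≡ count[ k ] z ys) (xs ++ ys) →
                   ∀ z → count[ k ] z xs ≡ count[ k ] z ys
    counts-agree k xs ys agree z with any? (z ∼?[ k ]_) (xs ++ ys)
    ... | yes z∼some = let w , w∈ , z∼w = find z∼some in
      trans (count[]-resp k z∼w xs) (trans (All.lookup agree w∈) (sym (count[]-resp k z∼w ys)))
    ... | no z≁all = let none-xs , none-ys = All.++⁻ xs (¬Any⇒All¬ (xs ++ ys) z≁all) in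
      trans (count-none _ none-xs) (sym (count-none _ none-ys))

    _∼?[_]_ : ∀ x k y → Dec (x ∼[ k ] y)
    x ∼?[ zero ] y = yes tt
    x ∼?[ suc k ] y with x ∼?[ k ] y
    ... | no x≁y = no (x≁y ∘ proj₁)
    ... | yes x∼y with All.all? (λ z → count[ k ] z (neighbours x) ≟ℕ count[ k ] z (neighbours y))
                                (neighbours x ++ neighbours y)
    ...   | yes agree = yes (x∼y , counts-agree k (neighbours x) (neighbours y) agree)
    ...   | no ¬agree = no λ x∼y′ → ¬agree (All.tabulate λ {z} _ → proj₂ x∼y′ z)

  ∼-refl : ∀ k {x} → x ∼[ k ] x
  ∼-refl zero = tt
  ∼-refl (suc k) = ∼-refl k , λ _ → refl

  count[]-pointwise : ∀ j {xs ys} → Pointwise (_∼[ j ]_) xs ys → ∀ z → count[ j ] z xs ≡ count[ j ] z ys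
  count[]-pointwise j xs∼ys z =
    count-pointwise (z ∼?[ j ]_) (z ∼?[ j ]_)
      (λ x∼y z∼x → ∼-trans j z∼x x∼y) (λ x∼y z∼y → ∼-trans j z∼y (∼-sym j x∼y)) xs∼ys

  ∼-cancel : ∀ j {a b cs ds} → Pointwise (_∼[ j ]_) cs ds →
             (∀ z → count[ j ] z (a ∷ cs) ≡ count[ j ] z (b ∷ ds)) → a ∼[ j ] b
  ∼-cancel j {a} {b} {cs} {ds} cs∼ds agree with a ∼?[ j ] b
  ... | yes a∼b = a∼b
  ... | no a≁b = contradiction (begin
    suc (count[ j ] a cs) ≡⟨ cong length (filter-accept (a ∼?[ j ]_) (∼-refl j)) ⟨
    count[ j ] a (a ∷ cs) ≡⟨ agree a ⟩
    count[ j ] a (b ∷ ds) ≡⟨ cong length (filter-reject (a ∼?[ j ]_) a≁b) ⟩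
    count[ j ] a ds       ≡⟨ count[]-pointwise j cs∼ds a ⟨
    count[ j ] a cs       ∎) 1+n≢n

  Joins-Tree^ : ∀ a d z w → Joins (Tree^ a) d z w ⇔ Joins UnfoldingTree d z w
  Joins-Tree^ a d z w with onRootPath d a
  ... | true  = mk⇔ swap swap
  ... | false = mk⇔ id id

  Tree^-≅-Adjacent : ∀ {a b} (iso : Tree^ a ≅ Tree^ b) {z w} → Adjacent z w →
                     Adjacent (Inverse.to (proj₁ iso) z) (Inverse.to (proj₁ iso) w)
  Tree^-≅-Adjacent {a} {b} iso (d , d-joins) =
    _ , Equivalence.to (Joins-Tree^ b _ _ _)
          (≅-Joins {Tree^ a} {Tree^ b} iso (Equivalence.from (Joins-Tree^ a _ _ _) d-joins))

  module TreeIsomorphism {a b} (iso : Tree^ a ≅ Tree^ b) where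
    φ φ⁻ : TV → TV
    φ  = Inverse.to (proj₁ iso)
    φ⁻ = Inverse.from (proj₁ iso)

    iso⁻ : Tree^ b ≅ Tree^ a
    iso⁻ = ≅-sym {Tree^ a} {Tree^ b} iso

    neighbours-φ : ∀ z → neighbours (φ z) ↭ map φ (neighbours z)
    neighbours-φ z = ∼bag⇒↭ (unique∧set⇒bag (neighbours-unique (φ z))
                               (Unique.map⁺ (Injection.injective (↔⇒↣ (proj₁ iso))) (neighbours-unique z))
                               (mk⇔ into onto))
      where
      into : ∀ {w} → w ∈ neighbours (φ z) → w ∈ map φ (neighbours z)
      into {w} w∈ = subst (_∈ map φ (neighbours z)) (Inverse.strictlyInverseˡ (proj₁ iso) w)
                          (∈-map⁺ φ (Adjacent⇒∈-neighbours pulled-back))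
        where
        pulled-back : Adjacent z (φ⁻ w)
        pulled-back = subst (λ x → Adjacent x (φ⁻ w)) (Inverse.strictlyInverseʳ (proj₁ iso) z)
                            (Tree^-≅-Adjacent {b} {a} iso⁻ (∈-neighbours⇒Adjacent (φ z) w∈))
      onto : ∀ {w} → w ∈ map φ (neighbours z) → w ∈ neighbours (φ z)
      onto w∈ with ∈-map⁻ φ w∈
      ... | u , u∈ , refl =
        Adjacent⇒∈-neighbours (Tree^-≅-Adjacent {a} {b} iso (∈-neighbours⇒Adjacent z u∈))

    ∼-φ : ∀ k z → z ∼[ k ] φ z
    ∼-φ zero z = tt
    ∼-φ (suc k) z = ∼-φ k z , λ u → sym (begin
      count[ k ] u (neighbours (φ z))     ≡⟨ count-↭ (u ∼?[ k ]_) (neighbours-φ z) ⟩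
      count[ k ] u (map φ (neighbours z)) ≡⟨ count-pointwise (u ∼?[ k ]_) (u ∼?[ k ]_)
                                               (λ φx∼x u∼φx → ∼-trans k u∼φx φx∼x)
                                               (λ φx∼x u∼x → ∼-trans k u∼x (∼-sym k φx∼x))
                                               (φ-related (neighbours z)) ⟩
      count[ k ] u (neighbours z)         ∎)
      where
      φ-related : ∀ xs → Pointwise (_∼[ k ]_) (map φ xs) xs
      φ-related [] = []
      φ-related (x ∷ xs) = ∼-sym k (∼-φ k x) ∷ φ-related xs

    φ-centre : φ a ≡ b
    φ-centre with φ a ≟ᵀ b
    ... | yes φa≡b = φa≡b
    ... | no φa≢b with Tree^-edge-into b (φ a) φa≢b
    ...   | d , d↦φa = contradiction
      (trans (proj₂ (proj₂ (proj₂ iso⁻)) d) (trans (cong φ⁻ d↦φa) (Inverse.strictlyInverseʳ (proj₁ iso) a)))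
      (Tree^-no-edge-into a _)

  Tree^-≅⇒∼ : ∀ {a b} → Tree^ a ≅ Tree^ b → ∀ k → a ∼[ k ] b
  Tree^-≅⇒∼ {a} {b} iso k = subst (a ∼[ k ]_) φ-centre (∼-φ k a)
    where open TreeIsomorphism {a} {b} iso

  -- Stabilisation of colour refinement under cocompactness

  Unstable : ℕ → Set
  Unstable j = ∃[ x ] ∃[ y ] x ∼[ j ] y × ¬ x ∼[ suc j ] y

  -- Some z is counted differently in the neighbourhoods at level j + 1 but not at level j, so
  -- some neighbour w has z ∼[ j ] w but not z ∼[ suc j ] w.
  unstable-pred : ∀ j → Unstable (suc j) → Unstable j
  unstable-pred j (x , y , x∼y , x≁y)
    with find (¬All⇒Any¬ (λ z → count[ suc j ] z (neighbours x) ≟ℕ count[ suc j ] z (neighbours y))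
                           (neighbours x ++ neighbours y)
                           (x≁y ∘ (x∼y ,_) ∘ counts-agree (suc j) (neighbours x) (neighbours y)))
  ... | z , _ , counts≢
    with any? (λ w → (z ∼?[ j ] w) ×-dec ¬? (z ∼?[ suc j ] w)) (neighbours x ++ neighbours y)
  ...   | yes found = let w , _ , z∼w , z≁w = find found in z , w , z∼w , z≁w
  ...   | no none = contradiction (begin
          count[ suc j ] z (neighbours x) ≡⟨ levels-agree (neighbours x) ∈-++⁺ˡ ⟩
          count[ j ] z (neighbours x)     ≡⟨ proj₂ x∼y z ⟩
          count[ j ] z (neighbours y)     ≡⟨ levels-agree (neighbours y) (∈-++⁺ʳ (neighbours x)) ⟨
          count[ suc j ] z (neighbours y) ∎) counts≢
    where
    levels-agree : ∀ xs → (∀ {w} → w ∈ xs → w ∈ neighbours x ++ neighbours y) →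
                   count[ suc j ] z xs ≡ count[ j ] z xs
    levels-agree xs sub = count-cong-∈ (z ∼?[ suc j ]_) (z ∼?[ j ]_) xs (λ _ → proj₁)
      (λ w∈ z∼w → decidable-stable (z ∼?[ suc j ] _) λ z≁w →
                    All.lookup (¬Any⇒All¬ _ none) (sub w∈) (z∼w , z≁w))

  Separated : ℕ → ℕ → Set
  Separated j c = Σ (Fin c → TV) λ f → ∀ {i i′} → i ≢ i′ → ¬ f i ∼[ j ] f i′

  avoid-all : ∀ {j c} ((f , f-sep) : Separated j c) {i₀ x v} → f i₀ ∼[ j ] x → v ∼[ j ] x →
              ¬ f i₀ ∼[ suc j ] v → ∀ i → ¬ f i ∼[ suc j ] v
  avoid-all {j} (f , f-sep) {i₀} fi₀∼x v∼x fi₀≁v i with i ≟ i₀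
  ... | yes refl = fi₀≁v
  ... | no i≢i₀ = λ fi∼v → f-sep i≢i₀ (∼-trans j (∼-trans j (proj₁ fi∼v) v∼x) (∼-sym j fi₀∼x))

  fresh-class : ∀ {j c} ((f , _) : Separated j c) → Unstable j → ∃[ v ] ∀ i → ¬ f i ∼[ suc j ] v
  fresh-class {j} S@(f , _) (x , y , x∼y , x≁y) with anyFin? (λ i → f i ∼?[ j ] x)
  ... | no none = x , λ i fi∼x → none (i , proj₁ fi∼x)
  ... | yes (i₀ , fi₀∼x) with f i₀ ∼?[ suc j ] x
  ...   | no fi₀≁x = x , avoid-all S fi₀∼x (∼-refl j) fi₀≁x
  ...   | yes fi₀∼x′ =
    y , avoid-all S fi₀∼x (∼-sym j x∼y) (x≁y ∘ ∼-trans (suc j) (∼-sym (suc j) fi₀∼x′))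

  separated-extend : ∀ {j c} → Separated j c → Unstable j → Separated (suc j) (suc c)
  separated-extend {j} S@(f , f-sep) u with fresh-class S u
  ... | v , v-fresh = g , g-sep
    where
    g : Fin _ → TV
    g zero = v
    g (suc i) = f i
    g-sep : ∀ {i i′} → i ≢ i′ → ¬ g i ∼[ suc j ] g i′
    g-sep {zero}  {zero}   ne = contradiction refl ne
    g-sep {zero}  {suc i′} _  = v-fresh i′ ∘ ∼-sym (suc j)
    g-sep {suc i} {zero}   _  = v-fresh i
    g-sep {suc i} {suc i′} ne = f-sep (ne ∘ cong suc) ∘ proj₁

  unstable⇒separated : ∀ j → Unstable j → Separated (suc j) (suc (suc j))
  unstable⇒separated zero u@(x , _) =
    separated-extend ((λ _ → x) , λ { {zero} {zero} ne → contradiction refl ne }) u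
  unstable⇒separated (suc j) u = separated-extend (unstable⇒separated j (unstable-pred j u)) u

  cocompact⇒stable : CocompactUnfolding → ∃[ k ] ∀ {x y} → x ∼[ k ] y → x ∼[ suc k ] y
  cocompact⇒stable (k , τ , τ-iso) = k , stable
    where
    stable : ∀ {x y} → x ∼[ k ] y → x ∼[ suc k ] y
    stable {x} {y} x∼y with x ∼?[ suc k ] y
    ... | yes x∼′y = x∼′y
    ... | no x≁y with unstable⇒separated k (x , y , x∼y , x≁y)
    ...   | f , f-sep with pigeonhole (s≤s (n≤1+n k)) (τ ∘ f)
    ...     | i , i′ , i<i′ , τ≡ = contradiction (Tree^-≅⇒∼ (τ-iso _ _ τ≡) (suc k)) (f-sep (<⇒≢ i<i′))

  -- Tree vertices over the same graph vertex

  -- Paths are stored last edge first, so w is a common final segment of the two paths.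
  SameLastEdges : ℕ → TV → TV → Set
  SameLastEdges j x y = ∃[ w ] ∃[ p ] ∃[ q ] path x ≡ w ++ p × path y ≡ w ++ q × j ≤ length w

  SameLastEdges⇒∼ : ∀ j x y → SameLastEdges (suc j) x y → x ∼[ j ] y
  SameLastEdges⇒∼ zero _ _ _ = tt
  SameLastEdges⇒∼ (suc j) x@(.(f ∷ w ++ p) , ext .f _ _) y@(.(f ∷ w ++ q) , ext .f _ _)
                  (f ∷ w , p , q , refl , refl , s≤s len) =
    SameLastEdges⇒∼ j x y (f ∷ w , p , q , refl , refl , m≤n⇒m≤1+n len) ,
    count[]-pointwise j (SameLastEdges⇒∼ j _ _ (w , p , q , refl , refl , len) ∷
                         Pointwise.map grandchildren (children-pointwise x y refl))
    where
    grandchildren : ∀ {a b} → ChildPair x y a b → a ∼[ j ] b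
    grandchildren {a} {b} (g , a≡ , b≡) =
      SameLastEdges⇒∼ j a b (g ∷ f ∷ w , p , q , a≡ , b≡ , m≤n⇒m≤1+n (m≤n⇒m≤1+n len))

  module _ (k : ℕ) (stable : ∀ {x y} → x ∼[ k ] y → x ∼[ suc k ] y) (no-sinks : NoSinks) where

    Alike : ℕ → TV → TV → Set
    Alike j x y = SameLastEdges j x y × end x ≡ end y

    Resolved : ℕ → Set
    Resolved j = ∀ x y → Alike j x y → x ∼[ k ] y

    resolved-pred : ∀ j → Resolved (suc j) → Resolved j
    resolved-pred j hyp x y ((w , p , q , x≡ , y≡ , len) , ends≡) with no-sinks (end x)
    ... | e , h =
      ∼-cancel k (Pointwise.map siblings (children-pointwise x′ y′ refl)) (proj₂ (stable (hyp x′ y′ alike′)))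
      where
      x′ y′ : TV
      x′ = child x e h
      y′ = child y e (trans h ends≡)
      alike′ : Alike (suc j) x′ y′
      alike′ = (e ∷ w , p , q , cong (e ∷_) x≡ , cong (e ∷_) y≡ , s≤s len) , refl
      siblings : ∀ {a b} → ChildPair x′ y′ a b → a ∼[ k ] b
      siblings {_ , _} {_ , _} (g , refl , refl) =
        hyp _ _ ((g ∷ e ∷ w , p , q , cong (λ r → g ∷ e ∷ r) x≡ , cong (λ r → g ∷ e ∷ r) y≡ ,
                  s≤s (m≤n⇒m≤1+n len)) , refl)

    resolved-down : ∀ d j → Resolved (d + j) → Resolved j
    resolved-down zero j hyp = hyp
    resolved-down (suc d) j hyp = resolved-pred j (resolved-down d (suc j) (subst Resolved (sym (+-suc d j)) hyp))

    same-end⇒∼ : ∀ {x y} → end x ≡ end y → x ∼[ k ] y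
    same-end⇒∼ {x} {y} ends≡ =
      resolved-down (suc k) 0 deep x y (([] , path x , path y , refl , refl , z≤n) , ends≡)
      where
      deep : Resolved (suc k + 0)
      deep x y (s , _) = SameLastEdges⇒∼ k x y (subst (λ i → SameLastEdges i x y) (+-identityʳ (suc k)) s)

    module _ (rooted : Rooted) (no-edge-into-root : NoEdgeIntoRoot) where

      over : Fin n → TV
      over v = proj₁ (rooted v) , proj₁ (proj₂ (rooted v))

      end-over : ∀ v → end (over v) ≡ v
      end-over v = proj₂ (proj₂ (rooted v))

      ∼-over : ∀ x → x ∼[ k ] over (end x)
      ∼-over x = same-end⇒∼ (sym (end-over (end x)))

      label : Fin n → Fin n
      label v = least (λ u → over u ∼?[ k ] over v) (v , ∼-refl k)

      label-≡ : ∀ {u v} → over u ∼[ k ] over v → label u ≡ label v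
      label-≡ u∼v = least-cong _ _ _ _ (λ _ w∼u → ∼-trans k w∼u u∼v) (λ _ w∼v → ∼-trans k w∼v (∼-sym k u∼v))

      label-∼ : ∀ v → over (label v) ∼[ k ] over v
      label-∼ v = least-satisfies (λ u → over u ∼?[ k ] over v) (v , ∼-refl k)

      label-≡⁻ : ∀ {u v} → label u ≡ label v → over u ∼[ k ] over v
      label-≡⁻ {u} {v} lu≡lv =
        ∼-trans k (∼-sym k (label-∼ u)) (subst (λ w → over w ∼[ k ] over v) (sym lu≡lv) (label-∼ v))

      labelCount : List TV → Fin n → ℕ
      labelCount xs y = count (λ p → label (end p) ≟ y) xs

      count[]-over : ∀ u xs → count[ k ] (over u) xs ≡ labelCount xs (label u)
      count[]-over u xs = cong length (filter-≐ (over u ∼?[ k ]_) (λ p → label (end p) ≟ label u)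
        ((λ u∼p → label-≡ (∼-trans k (∼-sym k (∼-over _)) (∼-sym k u∼p))) ,
         (λ lp≡lu → ∼-trans k (label-≡⁻ (sym lp≡lu)) (∼-sym k (∼-over _)))) xs)

      labelCount-outside : ∀ {y} → (∀ u → label u ≢ y) → ∀ xs → labelCount xs y ≡ 0
      labelCount-outside {y} outside xs =
        count-none (λ p → label (end p) ≟ y) {xs} (All.tabulate λ {p} _ → outside (end p))

      childrenVia-labelCount : ∀ x y es →
        labelCount (childrenVia x es) y ≡ count (λ e → (o e ≟ end x) ×-dec (label (t e) ≟ y)) es
      childrenVia-labelCount x y [] = refl
      childrenVia-labelCount x y (e ∷ es) with o e ≟ end x
      ... | no _ = childrenVia-labelCount x y es
      ... | yes _ with label (t e) ≟ y
      ...   | yes _ = cong suc (childrenVia-labelCount x y es)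
      ...   | no _  = childrenVia-labelCount x y es

      neighbours-labelCount : ∀ v y →
        labelCount (neighbours (over v)) y ≡ labelCount (parent (over v)) y + labelMult label v y
      neighbours-labelCount v y = begin
        labelCount (neighbours (over v)) y
          ≡⟨ count-++ (λ p → label (end p) ≟ y) (parent (over v)) (children (over v)) ⟩
        labelCount (parent (over v)) y + labelCount (children (over v)) y
          ≡⟨ cong (labelCount (parent (over v)) y +_) children-count ⟩
        labelCount (parent (over v)) y + labelMult label v y
          ∎
        where
        children-count : labelCount (children (over v)) y ≡ labelMult label v y
        children-count =
          subst (λ w → labelCount (children (over v)) y ≡ count (λ e → (o e ≟ w) ×-dec (label (t e) ≟ y)) (allFin m))
                (end-over v) (childrenVia-labelCount (over v) y (allFin m))

      labelCount-neighbours-≡ : ∀ {u v} → label u ≡ label v → ∀ y →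
                                labelCount (neighbours (over u)) y ≡ labelCount (neighbours (over v)) y
      labelCount-neighbours-≡ {u} {v} lu≡lv y with anyFin? (λ w → label w ≟ y)
      ... | yes (w , refl) = begin
        labelCount (neighbours (over u)) (label w) ≡⟨ count[]-over w (neighbours (over u)) ⟨
        count[ k ] (over w) (neighbours (over u))  ≡⟨ proj₂ (stable (label-≡⁻ lu≡lv)) (over w) ⟩
        count[ k ] (over w) (neighbours (over v))  ≡⟨ count[]-over w (neighbours (over v)) ⟩
        labelCount (neighbours (over v)) (label w) ∎
      ... | no outside = trans (labelCount-outside (λ w → outside ∘ (w ,_)) (neighbours (over u)))
                               (sym (labelCount-outside (λ w → outside ∘ (w ,_)) (neighbours (over v))))

      M : Fin n → Fin n → ℕ
      M x = labelCount (neighbours (over x))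

      M-label : ∀ v y → M (label v) y ≡ labelCount (neighbours (over v)) y
      M-label v = labelCount-neighbours-≡ (label-≡ (label-∼ v))

      parentLabelOf : TV → Fin n
      parentLabelOf ([] , _) = label R  -- junk: the root has no parent and l_p is unconstrained at R
      parentLabelOf (_ ∷ es , _) = label (endR es)

      parentLabel : Fin n → Fin n
      parentLabel v = parentLabelOf (over v)

      parent-labelCount : ∀ x → path x ≢ [] → ∀ y →
                          labelCount (parent x) y ≡ (if does (y ≟ parentLabelOf x) then 1 else 0)
      parent-labelCount ([] , _) nonroot y = contradiction refl nonroot
      parent-labelCount (_ ∷ es , ext _ _ _) _ y with label (endR es) ≟ y | y ≟ label (endR es)
      ... | yes _  | yes _ = refl
      ... | no _   | no _  = refl
      ... | yes eq | no ne = contradiction (sym eq) ne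
      ... | no ne  | yes eq = contradiction (sym eq) ne

      root-parent-labelCount : ∀ x → end x ≡ R → ∀ y → labelCount (parent x) y ≡ 0
      root-parent-labelCount ([] , ε) _ y = refl
      root-parent-labelCount (e ∷ _ , ext _ _ _) te≡R y = contradiction te≡R (no-edge-into-root e)

      over-nonroot : ∀ v → v ≢ R → path (over v) ≢ []
      over-nonroot v v≢R path≡[] = v≢R (trans (sym (end-over v)) (root-end (over v) path≡[]))
        where
        root-end : ∀ x → path x ≡ [] → end x ≡ R
        root-end ([] , ε) _ = refl

      incoming-parentLabel : ∀ x e → path x ≢ [] → t e ≡ end x → label (o e) ≡ parentLabelOf x
      incoming-parentLabel ([] , _) _ nonroot _ = contradiction refl nonroot
      incoming-parentLabel x@(_ ∷ es , ext _ w _) e _ te≡ = label-≡ (∼-trans k parents∼ (∼-over (es , w)))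
        where
        x₁ : TV
        x₁ = child (over (o e)) e (sym (end-over (o e)))
        siblings : ∀ {a b} → ChildPair x₁ x a b → a ∼[ k ] b
        siblings {_ , _} {_ , _} (_ , refl , refl) = same-end⇒∼ refl
        parents∼ : over (o e) ∼[ k ] (es , w)
        parents∼ = ∼-cancel k (Pointwise.map siblings (children-pointwise x₁ x te≡))
                              (proj₂ (stable {x₁} {x} (same-end⇒∼ te≡)))

      M-insert : ∀ v → v ≢ R → ∀ y → M (label v) y ≡ insertOne (labelMult label v) (parentLabel v) y
      M-insert v v≢R y = begin
        M (label v) y
          ≡⟨ M-label v y ⟩
        labelCount (neighbours (over v)) y
          ≡⟨ neighbours-labelCount v y ⟩
        labelCount (parent (over v)) y + labelMult label v y
          ≡⟨ cong (_+ labelMult label v y) (parent-labelCount (over v) (over-nonroot v v≢R) y) ⟩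
        insertOne (labelMult label v) (parentLabel v) y
          ∎

      M-root : ∀ y → labelMult label R y ≡ M (label R) y
      M-root y = begin
        labelMult label R y
          ≡⟨ cong (_+ labelMult label R y) (root-parent-labelCount (over R) (end-over R) y) ⟨
        labelCount (parent (over R)) y + labelMult label R y
          ≡⟨ neighbours-labelCount R y ⟨
        labelCount (neighbours (over R)) y
          ≡⟨ M-label R y ⟨
        M (label R) y
          ∎

      actualLabelling : ActualLabelling
      actualLabelling = record
        { k = n
        ; l = label
        ; lp = parentLabel
        ; M = M
        ; cond1 = λ v v≢R → insertOne-∋ (M-insert v v≢R)
        ; cond2 = λ v v≢R → removeOne-insertOne (M-insert v v≢R)
        ; cond3 = λ v v≢R e te≡v →
            incoming-parentLabel (over v) e (over-nonroot v v≢R) (trans te≡v (sym (end-over v)))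
        ; cond4 = M-root
        }

theorem1p2 : (n m : ℕ) (o t : Fin m → Fin n) (R : Fin n) →
    FinGraph.Rooted o t R →
    FinGraph.NoSinks o t R →
    FinGraph.NoEdgeIntoRoot o t R →
    2 < FinGraph.outdeg o t R R →
    FinGraph.CocompactUnfolding o t R →
    FinGraph.ActualLabelling o t R
theorem1p2 n m o t R rooted no-sinks no-edge-into-root _ cocompact =
  let k , stable = cocompact⇒stable cocompact in
  actualLabelling k stable no-sinks rooted no-edge-into-root
  where open Unfolding o t R
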